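{- Let $G$ be a connected graph and let $H_1,\ldots,H_k$ be subgraphs of $G$, each isometric in $G$, with $\bigcup_{i=1}^k V(H_i)=V(G)$. Then $\mathrm{gp}(G)\le \sum_{i=1}^k \mathrm{gp}(H_i)$.
   Context: A subgraph $H$ of $G$ is isometric if $d_H(x,y)=d_G(x,y)$ for all $x,y\in V(H)$. For a connected graph $G$, a set $S\subseteq V(G)$ is a general position set if no three distinct vertices of $S$ lie on a common geodesic (shortest path) of $G$, i.e. there are no distinct $x,y,z\in S$ with $d_G(x,z)=d_G(x,y)+d_G(y,z)$; $\mathrm{gp}(G)$ denotes the maximum cardinality of a general position set of $G$. -}

module Defs where

open import Data.Nat using (ℕ; zero; suc; _+_; _≤_)
open import Data.Fin using (Fin)
open import Data.Fin.Subset using (Subset; _∈_; _⊆_; ∣_∣; ⊤)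
open import Data.Product using (Σ; ∃; _×_)
open import Relation.Nullary using (¬_)
open import Relation.Binary.PropositionalEquality using (_≡_; _≢_)

record Graph (n : ℕ) : Set₁ where
  field
    Adj    : Fin n → Fin n → Set
    sym    : ∀ {x y} → Adj x y → Adj y x
    irrefl : ∀ {x} → ¬ Adj x x

data Walk {n : ℕ} (E : Fin n → Fin n → Set) : Fin n → Fin n → ℕ → Set where
  [] : ∀ {x} → Walk E x x 0
  _∷_ : ∀ {x y z k} → E x y → Walk E y z k → Walk E x z (suc k)

Dist : {n : ℕ} → (Fin n → Fin n → Set) → Fin n → Fin n → ℕ → Set
Dist E x y d = Walk E x y d × (∀ k → Walk E x y k → d ≤ k)

Connected : {n : ℕ} → Graph n → Set
Connected G = ∀ x y → ∃ λ k → Walk (Graph.Adj G) x y k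

record Subgraph {n : ℕ} (G : Graph n) : Set₁ where
  field
    V       : Subset n
    E       : Fin n → Fin n → Set
    E-sym   : ∀ {x y} → E x y → E y x
    E⊆Adj   : ∀ {x y} → E x y → Graph.Adj G x y
    E-endsˡ : ∀ {x y} → E x y → x ∈ V
    E-endsʳ : ∀ {x y} → E x y → y ∈ V

Isometric : {n : ℕ} → (G : Graph n) → Subgraph G → Set
Isometric G H = ∀ x y → x ∈ Subgraph.V H → y ∈ Subgraph.V H → ∀ d →
  (Dist (Subgraph.E H) x y d → Dist (Graph.Adj G) x y d) ×
  (Dist (Graph.Adj G) x y d → Dist (Subgraph.E H) x y d)

-- S ⊆ V is a general position set in the graph (V, E): no three distinct
-- vertices of S lie on a common geodesic, i.e. there are no distinct x,y,z ∈ S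
-- with d(x,z) = d(x,y) + d(y,z).
IsGPSet : {n : ℕ} → (Fin n → Fin n → Set) → Subset n → Subset n → Set
IsGPSet E V S = S ⊆ V × (∀ x y z → x ∈ S → y ∈ S → z ∈ S →
  x ≢ y → y ≢ z → x ≢ z →
  ∀ a b → ¬ (Dist E x y a × Dist E y z b × Dist E x z (a + b)))

IsGPNumber : {n : ℕ} → (Fin n → Fin n → Set) → Subset n → ℕ → Set
IsGPNumber E V g = (Σ (Subset _) λ S → IsGPSet E V S × ∣ S ∣ ≡ g) ×
  (∀ S → IsGPSet E V S → ∣ S ∣ ≤ g)

GP : {n : ℕ} → Graph n → ℕ → Set
GP G g = IsGPNumber (Graph.Adj G) ⊤ g

GPSub : {n : ℕ} {G : Graph n} → Subgraph G → ℕ → Set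
GPSub H g = IsGPNumber (Subgraph.E H) (Subgraph.V H) g

∑ : (k : ℕ) → (Fin k → ℕ) → ℕ
∑ zero    f = 0
∑ (suc k) f = f Fin.zero + ∑ k (λ i → f (Fin.suc i))

-- Intersecting a maximum general position set S of G with the vertex sets
-- V(H₁), …, V(Hₖ) gives sets that cover S, and each S ∩ V(Hᵢ) is in general
-- position in Hᵢ: a geodesic of Hᵢ through three of its vertices would, by
-- isometry, be a geodesic of G through three vertices of S. Hence
-- gp(G) = ∣S∣ ≤ ∑ᵢ ∣S ∩ V(Hᵢ)∣ ≤ ∑ᵢ gp(Hᵢ).
module Submission where

open import Defs
open import Data.Nat using (ℕ; zero; suc; _≤_; z≤n; s≤s; _+_)
open import Data.Nat.Properties using (≤-trans; +-monoʳ-≤; +-mono-≤; +-suc)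
open import Data.Fin using (Fin) renaming (zero to fzero; suc to fsuc)
open import Data.Fin.Subset using (Subset; _∈_; _⊆_; _∩_; ∁; ∣_∣; inside; outside; Empty)
open import Data.Fin.Subset.Properties
  using (Empty-unique; ∣⊥∣≡0; x∈p∩q⁺; x∈p∩q⁻; p⊆q⇒∣p∣≤∣q∣; p∩q⊆p; p∩q⊆q; x∈∁p⇒x∉p)
open import Data.Empty using (⊥-elim)
open import Data.Product using (∃; _,_; proj₁; proj₂)
open import Data.Vec using ([]; _∷_)
open import Relation.Binary.PropositionalEquality using (subst; sym)

∑-mono-≤ : ∀ k {f h : Fin k → ℕ} → (∀ i → f i ≤ h i) → ∑ k f ≤ ∑ k h
∑-mono-≤ zero    f≤h = z≤n
∑-mono-≤ (suc k) f≤h = +-mono-≤ (f≤h fzero) (∑-mono-≤ k (λ i → f≤h (fsuc i)))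

∣p∣≤∣p∩q∣+∣p∩∁q∣ : ∀ {n} (p q : Subset n) → ∣ p ∣ ≤ ∣ p ∩ q ∣ + ∣ p ∩ ∁ q ∣
∣p∣≤∣p∩q∣+∣p∩∁q∣ []            []            = z≤n
∣p∣≤∣p∩q∣+∣p∩∁q∣ (outside ∷ p) (_ ∷ q)       = ∣p∣≤∣p∩q∣+∣p∩∁q∣ p q
∣p∣≤∣p∩q∣+∣p∩∁q∣ (inside ∷ p)  (inside ∷ q)  = s≤s (∣p∣≤∣p∩q∣+∣p∩∁q∣ p q)
∣p∣≤∣p∩q∣+∣p∩∁q∣ (inside ∷ p)  (outside ∷ q) =
  subst (suc ∣ p ∣ ≤_) (sym (+-suc ∣ p ∩ q ∣ ∣ p ∩ ∁ q ∣)) (s≤s (∣p∣≤∣p∩q∣+∣p∩∁q∣ p q))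

∩-monoˡ-⊆ : ∀ {n} {p p′ : Subset n} (q : Subset n) → p ⊆ p′ → p ∩ q ⊆ p′ ∩ q
∩-monoˡ-⊆ {p = p} q p⊆p′ x∈p∩q with x∈p∩q⁻ p q x∈p∩q
... | x∈p , x∈q = x∈p∩q⁺ (p⊆p′ x∈p , x∈q)

∣p∣≤∑∣p∩qᵢ∣ : ∀ {n} k (p : Subset n) (q : Fin k → Subset n) →
  (∀ {x} → x ∈ p → ∃ λ i → x ∈ q i) → ∣ p ∣ ≤ ∑ k (λ i → ∣ p ∩ q i ∣)
∣p∣≤∑∣p∩qᵢ∣ {n} zero p q covers =
  subst (λ r → ∣ r ∣ ≤ 0) (sym (Empty-unique p-empty)) (subst (_≤ 0) (sym (∣⊥∣≡0 n)) z≤n)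
  where
  p-empty : Empty p
  p-empty (x , x∈p) with covers x∈p
  ... | () , _
∣p∣≤∑∣p∩qᵢ∣ (suc k) p q covers =
  ≤-trans (∣p∣≤∣p∩q∣+∣p∩∁q∣ p (q fzero))
    (+-monoʳ-≤ ∣ p ∩ q fzero ∣
      (≤-trans (∣p∣≤∑∣p∩qᵢ∣ k p′ (λ i → q (fsuc i)) covers′)
        (∑-mono-≤ k (λ i → p⊆q⇒∣p∣≤∣q∣ (∩-monoˡ-⊆ (q (fsuc i)) (p∩q⊆p p (∁ (q fzero))))))))
  where
  p′ : Subset _
  p′ = p ∩ ∁ (q fzero)
  covers′ : ∀ {x} → x ∈ p′ → ∃ λ i → x ∈ q (fsuc i)
  covers′ {x} x∈p′ with x∈p∩q⁻ p (∁ (q fzero)) x∈p′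
  ... | x∈p , x∉q₀ with covers x∈p
  ... | fzero  , x∈q₀ = ⊥-elim (x∈∁p⇒x∉p x∉q₀ x∈q₀)
  ... | fsuc i , x∈qᵢ = i , x∈qᵢ

IsGPSet-⊆ : ∀ {n} {E : Fin n → Fin n → Set} {V S T : Subset n} →
  IsGPSet E V S → T ⊆ S → IsGPSet E V T
IsGPSet-⊆ (S⊆V , noGeodesic) T⊆S =
  (λ x∈T → S⊆V (T⊆S x∈T)) ,
  λ x y z x∈T y∈T z∈T → noGeodesic x y z (T⊆S x∈T) (T⊆S y∈T) (T⊆S z∈T)

isometric⇒IsGPSet : ∀ {n} {G : Graph n} {H : Subgraph G} {W S : Subset n} →
  Isometric G H → IsGPSet (Graph.Adj G) W S → S ⊆ Subgraph.V H →
  IsGPSet (Subgraph.E H) (Subgraph.V H) S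
isometric⇒IsGPSet {G = G} {H} {S = S} iso (_ , noGeodesic) S⊆V =
  S⊆V , λ x y z x∈S y∈S z∈S x≢y y≢z x≢z a b (dxy , dyz , dxz) →
    noGeodesic x y z x∈S y∈S z∈S x≢y y≢z x≢z a b
      ( toG x y x∈S y∈S a dxy , toG y z y∈S z∈S b dyz , toG x z x∈S z∈S (a + b) dxz )
  where
  toG : ∀ x y → x ∈ S → y ∈ S → ∀ d →
    Dist (Subgraph.E H) x y d → Dist (Graph.Adj G) x y d
  toG x y x∈S y∈S d = proj₁ (iso x y (S⊆V x∈S) (S⊆V y∈S) d)

theorem3p1 : (n : ℕ) (G : Graph n) → Connected G →
    (k : ℕ) (H : Fin k → Subgraph G) →
    (∀ i → Isometric G (H i)) →
    (∀ v → ∃ λ i → v ∈ Subgraph.V (H i)) →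
    (g : ℕ) → GP G g →
    (gs : Fin k → ℕ) → (∀ i → GPSub (H i) (gs i)) →
    g ≤ ∑ k gs
theorem3p1 n G _ k H isometric covers g ((S , S-gp , ∣S∣≡g) , _) gs gsᵢ-max =
  subst (_≤ ∑ k gs) ∣S∣≡g
    (≤-trans (∣p∣≤∑∣p∩qᵢ∣ k S V (λ {x} _ → covers x))
      (∑-mono-≤ k (λ i → proj₂ (gsᵢ-max i) (S ∩ V i) (S∩Vᵢ-gp i))))
  where
  V : Fin k → Subset n
  V i = Subgraph.V (H i)
  S∩Vᵢ-gp : ∀ i → IsGPSet (Subgraph.E (H i)) (V i) (S ∩ V i)
  S∩Vᵢ-gp i = isometric⇒IsGPSet {H = H i} (isometric i)
    (IsGPSet-⊆ S-gp (p∩q⊆p S (V i))) (p∩q⊆q S (V i))
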